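{- Let $(\rho^{\mathsf v},\rho^{\mathsf c},\chi)$ be a separated abstract higher-order GSOS law (as in the context), and let $\gamma\colon\mu\Sigma\to B(\mu\Sigma,\mu\Sigma)$ be the operational model of the associated law $\rho$. Let $\gamma^{\mathsf v}=\eta^T\circ D(\mathrm{id},\mu^\Sigma_0)\circ\rho^{\mathsf v}_{\mu\Sigma}\colon S_{\mathsf v}\to TD(\mu\Sigma,\mu\Sigma)$. Then there is a unique morphism $\gamma^{\mathsf c}\colon S_{\mathsf c}\to T\mu\Sigma$ such that $\gamma^{\mathsf c}\circ\Sigma_{\mathsf c}(\iota,\mathrm{id})=T\nabla^\sharp\circ\rho^{\mathsf c}_{\mu\Sigma,\mu\Sigma}\circ\Sigma_{\mathsf c}(\langle\iota,\gamma^{\mathsf v}+\gamma^{\mathsf c}\rangle,\mathrm{id})$ as morphisms $\Sigma_{\mathsf c}(S_{\mathsf v}+S_{\mathsf c},\mu\Sigma)\to T\mu\Sigma$. Moreover, $\gamma^{\mathsf v}+\gamma^{\mathsf c}=\gamma\circ\iota$.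
   Context: $\mathcal C$ is a distributive category; $\mathrm{inl},\mathrm{inr}$, $[f,g]$, $\langle f,g\rangle$, $\mathrm{fst},\mathrm{snd}$, $\nabla=[\mathrm{id},\mathrm{id}]$ as usual. $\Sigma_{\mathsf v}\colon\mathcal C\to\mathcal C$, $\Sigma_{\mathsf c}\colon\mathcal C\times\mathcal C\to\mathcal C$ are functors, $\Sigma X=\Sigma_{\mathsf v}X+\Sigma_{\mathsf c}(X,X)$, and $\Sigma'(X,Y)=\Sigma_{\mathsf v}Y+\Sigma_{\mathsf c}(X,Y)$ (so $\Sigma X=\Sigma'(X,X)$). Free $\Sigma$-algebras exist; $(\Sigma^\star,\eta^\Sigma,\mu^\Sigma)$ is the free monad; $\mu\Sigma=\Sigma^\star0$ with invertible structure $\iota\colon\Sigma\mu\Sigma\to\mu\Sigma$; $S_{\mathsf v}=\Sigma_{\mathsf v}\mu\Sigma$, $S_{\mathsf c}=\Sigma_{\mathsf c}(\mu\Sigma,\mu\Sigma)$, so $\Sigma\mu\Sigma=S_{\mathsf v}+S_{\mathsf c}$; $\nabla^\sharp=\mu^\Sigma_0\circ\Sigma^\star\nabla\colon\Sigma^\star(\mu\Sigma+\mu\Sigma)\to\mu\Sigma$; $\mu^\Sigma_0\colon\Sigma^\star\mu\Sigma\to\mu\Sigma$. $T$ is a strong monad with unit $\eta^T$, multiplication $m^T$; $D\colon\mathcal C^{op}\times\mathcal C\to\mathcal C$ is a functor, $B(X,Y)=TD(X,Y)+TY$. A separated abstract higher-order GSOS law is a triple $(\rho^{\mathsf v},\rho^{\mathsf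 c},\chi)$: $\rho^{\mathsf v}_X\colon\Sigma_{\mathsf v}X\to D(X,\Sigma^\star X)$ dinatural in $X$; $\rho^{\mathsf c}_{X,Y}\colon\Sigma_{\mathsf c}(X\times B(X,Y),X)\to T\Sigma^\star(X+Y)$ dinatural in $X$, natural in $Y$; $\chi_{X,Y}\colon\Sigma_{\mathsf c}(TX,Y)\to T\Sigma_{\mathsf c}(X,Y)$ natural, and for each $Y$ a distributive law of $T$ over $\Sigma_{\mathsf c}(-,Y)$. The associated law is $\rho_{X,Y}=(\eta^T\circ D(\mathrm{id},\Sigma^\star\mathrm{inl})\circ\rho^{\mathsf v}_X)+\rho^{\mathsf c}_{X,Y}\colon\Sigma'(X\times B(X,Y),X)=\Sigma_{\mathsf v}X+\Sigma_{\mathsf c}(X\times B(X,Y),X)\to B(X,\Sigma^\star(X+Y))$. Its operational model is the unique $\gamma\colon\mu\Sigma\to B(\mu\Sigma,\mu\Sigma)$ with $\gamma\circ\iota=B(\mathrm{id},\nabla^\sharp)\circ\rho_{\mu\Sigma,\mu\Sigma}\circ\Sigma'(\langle\mathrm{id},\gamma\rangle,\mathrm{id})$ (it is known to exist uniquely). In the claim, $\gamma^{\mathsf v}+\gamma^{\mathsf c}\colon S_{\mathsf v}+S_{\mathsf c}\to TD(\mu\Sigma,\mu\Sigma)+T\mu\Sigma=B(\mu\Sigma,\mu\Sigma)$. -}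

module Defs where

open import Level using (Level; _⊔_) renaming (suc to lsuc)
open import Relation.Binary.Core using (Rel)
open import Relation.Binary.Structures using (IsEquivalence)

record Category (o ℓ e : Level) : Set (lsuc (o ⊔ ℓ ⊔ e)) where
  infixr 9 _∘_
  infix  4 _≈_ _⇒_
  field
    Obj : Set o
    _⇒_ : Obj → Obj → Set ℓ
    _≈_ : ∀ {A B} → Rel (A ⇒ B) e
    id  : ∀ {A} → A ⇒ A
    _∘_ : ∀ {A B C} → B ⇒ C → A ⇒ B → A ⇒ C
    equiv     : ∀ {A B} → IsEquivalence (_≈_ {A} {B})
    assoc     : ∀ {A B C D} {f : A ⇒ B} {g : B ⇒ C} {h : C ⇒ D} →
                (h ∘ g) ∘ f ≈ h ∘ (g ∘ f)
    identityˡ : ∀ {A B} {f : A ⇒ B} → id ∘ f ≈ f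
    identityʳ : ∀ {A B} {f : A ⇒ B} → f ∘ id ≈ f
    ∘-resp-≈  : ∀ {A B C} {f h : B ⇒ C} {g i : A ⇒ B} →
                f ≈ h → g ≈ i → f ∘ g ≈ h ∘ i

record Distributive {o ℓ e} (C : Category o ℓ e) : Set (o ⊔ ℓ ⊔ e) where
  open Category C
  infixr 7 _×ₒ_
  infixr 6 _+ₒ_
  field
    𝟙        : Obj
    !        : ∀ {A} → A ⇒ 𝟙
    !-unique : ∀ {A} (f : A ⇒ 𝟙) → f ≈ !
    _×ₒ_      : Obj → Obj → Obj
    fst       : ∀ {A B} → A ×ₒ B ⇒ A
    snd       : ∀ {A B} → A ×ₒ B ⇒ B
    ⟨_,_⟩     : ∀ {X A B} → X ⇒ A → X ⇒ B → X ⇒ A ×ₒ B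
    fst-β     : ∀ {X A B} {f : X ⇒ A} {g : X ⇒ B} → fst ∘ ⟨ f , g ⟩ ≈ f
    snd-β     : ∀ {X A B} {f : X ⇒ A} {g : X ⇒ B} → snd ∘ ⟨ f , g ⟩ ≈ g
    ⟨⟩-unique : ∀ {X A B} {f : X ⇒ A} {g : X ⇒ B} {h : X ⇒ A ×ₒ B} →
                fst ∘ h ≈ f → snd ∘ h ≈ g → h ≈ ⟨ f , g ⟩
    𝟘        : Obj
    ¡        : ∀ {A} → 𝟘 ⇒ A
    ¡-unique : ∀ {A} (f : 𝟘 ⇒ A) → f ≈ ¡
    _+ₒ_      : Obj → Obj → Obj
    inl       : ∀ {A B} → A ⇒ A +ₒ B
    inr       : ∀ {A B} → B ⇒ A +ₒ B
    [_,_]     : ∀ {A B X} → A ⇒ X → B ⇒ X → A +ₒ B ⇒ X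
    inl-β     : ∀ {A B X} {f : A ⇒ X} {g : B ⇒ X} → [ f , g ] ∘ inl ≈ f
    inr-β     : ∀ {A B X} {f : A ⇒ X} {g : B ⇒ X} → [ f , g ] ∘ inr ≈ g
    []-unique : ∀ {A B X} {f : A ⇒ X} {g : B ⇒ X} {h : A +ₒ B ⇒ X} →
                h ∘ inl ≈ f → h ∘ inr ≈ g → h ≈ [ f , g ]
    distrib⁻¹ : ∀ {A B C} → A ×ₒ (B +ₒ C) ⇒ (A ×ₒ B) +ₒ (A ×ₒ C)
    distrib-isoˡ : ∀ {A B C} →
      distrib⁻¹ ∘ [ ⟨ fst , inl ∘ snd ⟩ , ⟨ fst , inr ∘ snd ⟩ ] ≈ id {(A ×ₒ B) +ₒ (A ×ₒ C)}
    distrib-isoʳ : ∀ {A B C} →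
      [ ⟨ fst , inl ∘ snd ⟩ , ⟨ fst , inr ∘ snd ⟩ ] ∘ distrib⁻¹ ≈ id {A ×ₒ (B +ₒ C)}
    annul⁻¹     : ∀ {A} → A ×ₒ 𝟘 ⇒ 𝟘
    annul-isoˡ  : ∀ {A} → annul⁻¹ {A} ∘ ¡ ≈ id {𝟘}
    annul-isoʳ  : ∀ {A} → ¡ ∘ annul⁻¹ ≈ id {A ×ₒ 𝟘}

module DistOps {o ℓ e} {C : Category o ℓ e} (DC : Distributive C) where
  open Category C public
  open Distributive DC public

  infixr 7 _×₁_
  infixr 6 _+₁_

  _×₁_ : ∀ {A B A' B'} → A ⇒ A' → B ⇒ B' → A ×ₒ B ⇒ A' ×ₒ B'
  f ×₁ g = ⟨ f ∘ fst , g ∘ snd ⟩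

  _+₁_ : ∀ {A B A' B'} → A ⇒ A' → B ⇒ B' → A +ₒ B ⇒ A' +ₒ B'
  f +₁ g = [ inl ∘ f , inr ∘ g ]

  ∇ : ∀ {A} → A +ₒ A ⇒ A
  ∇ = [ id , id ]

  α : ∀ {A B C} → (A ×ₒ B) ×ₒ C ⇒ A ×ₒ (B ×ₒ C)
  α = ⟨ fst ∘ fst , ⟨ snd ∘ fst , snd ⟩ ⟩

record Endofunctor {o ℓ e} (C : Category o ℓ e) : Set (o ⊔ ℓ ⊔ e) where
  open Category C
  field
    F₀ : Obj → Obj
    F₁ : ∀ {A B} → A ⇒ B → F₀ A ⇒ F₀ B
    identity     : ∀ {A} → F₁ (id {A}) ≈ id
    homomorphism : ∀ {A B C} {f : A ⇒ B} {g : B ⇒ C} → F₁ (g ∘ f) ≈ F₁ g ∘ F₁ f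
    F-resp-≈     : ∀ {A B} {f g : A ⇒ B} → f ≈ g → F₁ f ≈ F₁ g

record Bifunctor {o ℓ e} (C : Category o ℓ e) : Set (o ⊔ ℓ ⊔ e) where
  open Category C
  field
    F₀ : Obj → Obj → Obj
    F₁ : ∀ {A A' B B'} → A ⇒ A' → B ⇒ B' → F₀ A B ⇒ F₀ A' B'
    identity     : ∀ {A B} → F₁ (id {A}) (id {B}) ≈ id
    homomorphism : ∀ {A A' A'' B B' B''} {f : A ⇒ A'} {f' : A' ⇒ A''}
                     {g : B ⇒ B'} {g' : B' ⇒ B''} →
                   F₁ (f' ∘ f) (g' ∘ g) ≈ F₁ f' g' ∘ F₁ f g
    F-resp-≈     : ∀ {A A' B B'} {f f' : A ⇒ A'} {g g' : B ⇒ B'} →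
                   f ≈ f' → g ≈ g' → F₁ f g ≈ F₁ f' g'

record MixedFunctor {o ℓ e} (C : Category o ℓ e) : Set (o ⊔ ℓ ⊔ e) where
  open Category C
  field
    F₀ : Obj → Obj → Obj
    F₁ : ∀ {A A' B B'} → A' ⇒ A → B ⇒ B' → F₀ A B ⇒ F₀ A' B'
    identity     : ∀ {A B} → F₁ (id {A}) (id {B}) ≈ id
    homomorphism : ∀ {A A' A'' B B' B''} {f : A' ⇒ A} {f' : A'' ⇒ A'}
                     {g : B ⇒ B'} {g' : B' ⇒ B''} →
                   F₁ (f ∘ f') (g' ∘ g) ≈ F₁ f' g' ∘ F₁ f g
    F-resp-≈     : ∀ {A A' B B'} {f f' : A' ⇒ A} {g g' : B ⇒ B'} →
                   f ≈ f' → g ≈ g' → F₁ f g ≈ F₁ f' g'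

record StrongMonad {o ℓ e} {C : Category o ℓ e} (DC : Distributive C)
       : Set (o ⊔ ℓ ⊔ e) where
  open DistOps DC
  field
    T : Endofunctor C
  open Endofunctor T
  field
    η : ∀ {A} → A ⇒ F₀ A
    m : ∀ {A} → F₀ (F₀ A) ⇒ F₀ A
    η-natural : ∀ {A B} {f : A ⇒ B} → F₁ f ∘ η ≈ η ∘ f
    m-natural : ∀ {A B} {f : A ⇒ B} → F₁ f ∘ m ≈ m ∘ F₁ (F₁ f)
    m-identityˡ : ∀ {A} → m ∘ F₁ (η {A}) ≈ id
    m-identityʳ : ∀ {A} → m ∘ η {F₀ A} ≈ id
    m-assoc     : ∀ {A} → m ∘ F₁ (m {A}) ≈ m ∘ m
    τ : ∀ {A B} → A ×ₒ F₀ B ⇒ F₀ (A ×ₒ B)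
    τ-natural : ∀ {A A' B B'} {f : A ⇒ A'} {g : B ⇒ B'} →
                F₁ (f ×₁ g) ∘ τ ≈ τ ∘ (f ×₁ F₁ g)
    τ-unit    : ∀ {A} → F₁ snd ∘ τ {𝟙} {A} ≈ snd
    τ-assoc   : ∀ {A B C} → F₁ α ∘ τ {A ×ₒ B} {C} ≈ τ ∘ (id ×₁ τ) ∘ α
    τ-η       : ∀ {A B} → τ ∘ (id ×₁ η) ≈ η {A ×ₒ B}
    τ-m       : ∀ {A B} → τ ∘ (id ×₁ m) ≈ m ∘ F₁ τ ∘ τ {A} {F₀ B}

module SigOps {o ℓ e} {C : Category o ℓ e} (DC : Distributive C)
              (Σᵥ : Endofunctor C) (Σ꜀ : Bifunctor C) where
  open DistOps DC
  private
    module Σᵥ = Endofunctor Σᵥ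
    module Σ꜀ = Bifunctor Σ꜀

  Σ₀ : Obj → Obj
  Σ₀ X = Σᵥ.F₀ X +ₒ Σ꜀.F₀ X X

  Σ₁ : ∀ {X Y} → X ⇒ Y → Σ₀ X ⇒ Σ₀ Y
  Σ₁ f = Σᵥ.F₁ f +₁ Σ꜀.F₁ f f

  Σ'₀ : Obj → Obj → Obj
  Σ'₀ X Y = Σᵥ.F₀ Y +ₒ Σ꜀.F₀ X Y

  Σ'₁ : ∀ {X X' Y Y'} → X ⇒ X' → Y ⇒ Y' → Σ'₀ X Y ⇒ Σ'₀ X' Y'
  Σ'₁ f g = Σᵥ.F₁ g +₁ Σ꜀.F₁ f g

record FreeAlgebras {o ℓ e} {C : Category o ℓ e} (DC : Distributive C)
       (Σᵥ : Endofunctor C) (Σ꜀ : Bifunctor C) : Set (o ⊔ ℓ ⊔ e) where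
  open DistOps DC
  open SigOps DC Σᵥ Σ꜀
  field
    Σ⋆  : Obj → Obj
    ηˢ  : ∀ {X} → X ⇒ Σ⋆ X
    alg : ∀ {X} → Σ₀ (Σ⋆ X) ⇒ Σ⋆ X
    ext : ∀ {X A} → Σ₀ A ⇒ A → X ⇒ A → Σ⋆ X ⇒ A
    ext-η   : ∀ {X A} {a : Σ₀ A ⇒ A} {f : X ⇒ A} → ext a f ∘ ηˢ ≈ f
    ext-alg : ∀ {X A} {a : Σ₀ A ⇒ A} {f : X ⇒ A} →
              ext a f ∘ alg ≈ a ∘ Σ₁ (ext a f)
    ext-unique : ∀ {X A} {a : Σ₀ A ⇒ A} {f : X ⇒ A} {h : Σ⋆ X ⇒ A} →
                 h ∘ ηˢ ≈ f → h ∘ alg ≈ a ∘ Σ₁ h → h ≈ ext a f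

  Σ⋆₁ : ∀ {X Y} → X ⇒ Y → Σ⋆ X ⇒ Σ⋆ Y
  Σ⋆₁ f = ext alg (ηˢ ∘ f)

  μˢ : ∀ {X} → Σ⋆ (Σ⋆ X) ⇒ Σ⋆ X
  μˢ = ext alg id

module Base {o ℓ e} {C : Category o ℓ e} (DC : Distributive C)
            (Σᵥ : Endofunctor C) (Σ꜀ : Bifunctor C)
            (FA : FreeAlgebras DC Σᵥ Σ꜀)
            (TM : StrongMonad DC) (D : MixedFunctor C) where
  open DistOps DC public
  open SigOps DC Σᵥ Σ꜀ public
  open FreeAlgebras FA public
  open StrongMonad TM public using (T; η; m; τ)
  module Σᵥ = Endofunctor Σᵥ
  module Σ꜀ = Bifunctor Σ꜀
  module T  = Endofunctor T
  module D  = MixedFunctor D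

  B₀ : Obj → Obj → Obj
  B₀ X Y = T.F₀ (D.F₀ X Y) +ₒ T.F₀ Y

  B₁ : ∀ {X X' Y Y'} → X' ⇒ X → Y ⇒ Y' → B₀ X Y ⇒ B₀ X' Y'
  B₁ f g = T.F₁ (D.F₁ f g) +₁ T.F₁ g

  μΣ : Obj
  μΣ = Σ⋆ 𝟘

  ι : Σ₀ μΣ ⇒ μΣ
  ι = alg

  Sᵥ : Obj
  Sᵥ = Σᵥ.F₀ μΣ

  S꜀ : Obj
  S꜀ = Σ꜀.F₀ μΣ μΣ

  μˢ₀ : Σ⋆ μΣ ⇒ μΣ
  μˢ₀ = μˢ

  ∇♯ : Σ⋆ (μΣ +ₒ μΣ) ⇒ μΣ
  ∇♯ = μˢ₀ ∘ Σ⋆₁ ∇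

record SeparatedLaw {o ℓ e} {C : Category o ℓ e} (DC : Distributive C)
       (Σᵥ : Endofunctor C) (Σ꜀ : Bifunctor C)
       (FA : FreeAlgebras DC Σᵥ Σ꜀)
       (TM : StrongMonad DC) (D : MixedFunctor C) : Set (o ⊔ ℓ ⊔ e) where
  open Base DC Σᵥ Σ꜀ FA TM D
  field
    ρᵛ : ∀ {X} → Σᵥ.F₀ X ⇒ D.F₀ X (Σ⋆ X)
    ρᵛ-dinatural : ∀ {X X'} (f : X ⇒ X') →
      D.F₁ id (Σ⋆₁ f) ∘ ρᵛ {X} ≈ D.F₁ f id ∘ ρᵛ {X'} ∘ Σᵥ.F₁ f
    ρᶜ : ∀ {X Y} → Σ꜀.F₀ (X ×ₒ B₀ X Y) X ⇒ T.F₀ (Σ⋆ (X +ₒ Y))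
    ρᶜ-dinatural : ∀ {X X' Y} (f : X ⇒ X') →
      T.F₁ (Σ⋆₁ (f +₁ id)) ∘ ρᶜ {X} {Y} ∘ Σ꜀.F₁ (id ×₁ B₁ f id) id
        ≈ ρᶜ {X'} {Y} ∘ Σ꜀.F₁ (f ×₁ id) f
    ρᶜ-natural : ∀ {X Y Y'} (g : Y ⇒ Y') →
      ρᶜ {X} {Y'} ∘ Σ꜀.F₁ (id ×₁ B₁ id g) id ≈ T.F₁ (Σ⋆₁ (id +₁ g)) ∘ ρᶜ {X} {Y}
    χ : ∀ {X Y} → Σ꜀.F₀ (T.F₀ X) Y ⇒ T.F₀ (Σ꜀.F₀ X Y)
    χ-natural : ∀ {X X' Y Y'} (f : X ⇒ X') (g : Y ⇒ Y') →
      T.F₁ (Σ꜀.F₁ f g) ∘ χ ≈ χ ∘ Σ꜀.F₁ (T.F₁ f) g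
    χ-η : ∀ {X Y} → χ ∘ Σ꜀.F₁ (η {X}) (id {Y}) ≈ η
    χ-m : ∀ {X Y} → χ ∘ Σ꜀.F₁ (m {X}) (id {Y}) ≈ m ∘ T.F₁ χ ∘ χ

module Setup {o ℓ e} {C : Category o ℓ e} (DC : Distributive C)
             (Σᵥ : Endofunctor C) (Σ꜀ : Bifunctor C)
             (FA : FreeAlgebras DC Σᵥ Σ꜀)
             (TM : StrongMonad DC) (D : MixedFunctor C)
             (L : SeparatedLaw DC Σᵥ Σ꜀ FA TM D) where
  open Base DC Σᵥ Σ꜀ FA TM D public
  open SeparatedLaw L public

  ρ : ∀ {X Y} → Σ'₀ (X ×ₒ B₀ X Y) X ⇒ B₀ X (Σ⋆ (X +ₒ Y))
  ρ = (η ∘ D.F₁ id (Σ⋆₁ inl) ∘ ρᵛ) +₁ ρᶜ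

  IsOperationalModel : μΣ ⇒ B₀ μΣ μΣ → Set e
  IsOperationalModel γ =
    γ ∘ ι ≈ B₁ id ∇♯ ∘ ρ {μΣ} {μΣ} ∘ Σ'₁ ⟨ id , γ ⟩ id

  γᵛ : Sᵥ ⇒ T.F₀ (D.F₀ μΣ μΣ)
  γᵛ = η ∘ D.F₁ id μˢ₀ ∘ ρᵛ {μΣ}

module Submission where

-- Since ι is invertible (Lambek), a candidate δ for γᶜ determines the candidate model
-- (γᵛ + δ) ∘ ι⁻¹, and δ solves the equation of the proposition exactly when this candidate
-- satisfies the operational-model equation, whose S꜀-component is T∇♯ ∘ ρᶜ ∘ Σ꜀(⟨id, -⟩, id).
-- Operational models are unique, because ⟨id, γ⟩ is an algebra morphism out of the initial
-- algebra μΣ (primitive recursion); so the only solution is the S꜀-component of γ ∘ ι.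

open import Defs
open import Data.Product using (Σ-syntax; _×_; _,_)
open import Relation.Binary.Bundles using (Setoid)
open import Relation.Binary.Structures using (IsEquivalence)
import Relation.Binary.Reasoning.Setoid as SetoidReasoning

module HomReasoning {o ℓ e} (C : Category o ℓ e) where
  open Category C

  hom-setoid : Obj → Obj → Setoid ℓ e
  hom-setoid A B = record { Carrier = A ⇒ B ; _≈_ = _≈_ ; isEquivalence = equiv }

  open module Equiv {A B : Obj} = IsEquivalence (equiv {A} {B}) public
    using (refl; sym; trans)
  open module Reasoning {A B : Obj} = SetoidReasoning (hom-setoid A B) public

  infixr 4 _⟩∘⟨_ refl⟩∘⟨_
  infixl 5 _⟩∘⟨refl

  _⟩∘⟨_ : ∀ {A B X} {f f' : B ⇒ X} {g g' : A ⇒ B} → f ≈ f' → g ≈ g' → f ∘ g ≈ f' ∘ g'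
  _⟩∘⟨_ = ∘-resp-≈

  refl⟩∘⟨_ : ∀ {A B X} {f : B ⇒ X} {g g' : A ⇒ B} → g ≈ g' → f ∘ g ≈ f ∘ g'
  refl⟩∘⟨ p = refl ⟩∘⟨ p

  _⟩∘⟨refl : ∀ {A B X} {f f' : B ⇒ X} {g : A ⇒ B} → f ≈ f' → f ∘ g ≈ f' ∘ g
  p ⟩∘⟨refl = p ⟩∘⟨ refl

  sym-assoc : ∀ {A B X Y} {f : A ⇒ B} {g : B ⇒ X} {h : X ⇒ Y} → h ∘ (g ∘ f) ≈ (h ∘ g) ∘ f
  sym-assoc = sym assoc

  split-epi-cancelʳ : ∀ {A B X} {r : A ⇒ B} {s : B ⇒ A} {f f' : B ⇒ X} →
                      r ∘ s ≈ id → f ∘ r ≈ f' ∘ r → f ≈ f'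
  split-epi-cancelʳ {r = r} {s} {f} {f'} r∘s≈id f∘r≈f'∘r = begin
    f            ≈⟨ sym identityʳ ⟩
    f ∘ id       ≈⟨ refl⟩∘⟨ sym r∘s≈id ⟩
    f ∘ r ∘ s    ≈⟨ sym-assoc ⟩
    (f ∘ r) ∘ s  ≈⟨ f∘r≈f'∘r ⟩∘⟨refl ⟩
    (f' ∘ r) ∘ s ≈⟨ assoc ⟩
    f' ∘ r ∘ s   ≈⟨ refl⟩∘⟨ r∘s≈id ⟩
    f' ∘ id      ≈⟨ identityʳ ⟩
    f'           ∎

module ProductCoproductLemmas {o ℓ e} {C : Category o ℓ e} (DC : Distributive C) where
  open DistOps DC
  open HomReasoning C

  ⟨⟩-cong : ∀ {X A B} {f f' : X ⇒ A} {g g' : X ⇒ B} → f ≈ f' → g ≈ g' → ⟨ f , g ⟩ ≈ ⟨ f' , g' ⟩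
  ⟨⟩-cong p q = ⟨⟩-unique (trans fst-β p) (trans snd-β q)

  ⟨⟩∘ : ∀ {Y X A B} {f : X ⇒ A} {g : X ⇒ B} {h : Y ⇒ X} → ⟨ f , g ⟩ ∘ h ≈ ⟨ f ∘ h , g ∘ h ⟩
  ⟨⟩∘ = ⟨⟩-unique (trans sym-assoc (fst-β ⟩∘⟨refl)) (trans sym-assoc (snd-β ⟩∘⟨refl))

  +₁-cong : ∀ {A B A' B'} {f f' : A ⇒ A'} {g g' : B ⇒ B'} →
            f ≈ f' → g ≈ g' → f +₁ g ≈ f' +₁ g'
  +₁-cong p q = []-unique (trans inl-β (refl⟩∘⟨ p)) (trans inr-β (refl⟩∘⟨ q))

  +₁-identity : ∀ {A B} → id {A} +₁ id {B} ≈ id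
  +₁-identity = sym ([]-unique (trans identityˡ (sym identityʳ)) (trans identityˡ (sym identityʳ)))

  +₁∘+₁ : ∀ {A B A' B' A'' B''} {f : A ⇒ A'} {g : B ⇒ B'} {f' : A' ⇒ A''} {g' : B' ⇒ B''} →
          (f' +₁ g') ∘ (f +₁ g) ≈ (f' ∘ f) +₁ (g' ∘ g)
  +₁∘+₁ {A} {B} {A'} {B'} {A''} {B''} {f} {g} {f'} {g'} =
    []-unique (injection-square inl-β inl-β) (injection-square inr-β inr-β)
    where
    injection-square : ∀ {P P' P''} {j : P ⇒ A +ₒ B} {j' : P' ⇒ A' +ₒ B'} {j'' : P'' ⇒ A'' +ₒ B''}
                         {u : P ⇒ P'} {u' : P' ⇒ P''} →
                       (f +₁ g) ∘ j ≈ j' ∘ u → (f' +₁ g') ∘ j' ≈ j'' ∘ u' →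
                       ((f' +₁ g') ∘ (f +₁ g)) ∘ j ≈ j'' ∘ (u' ∘ u)
    injection-square {j = j} {j'} {j''} {u} {u'} first second = begin
      ((f' +₁ g') ∘ (f +₁ g)) ∘ j ≈⟨ assoc ⟩
      (f' +₁ g') ∘ (f +₁ g) ∘ j   ≈⟨ refl⟩∘⟨ first ⟩
      (f' +₁ g') ∘ j' ∘ u         ≈⟨ sym-assoc ⟩
      ((f' +₁ g') ∘ j') ∘ u       ≈⟨ second ⟩∘⟨refl ⟩
      (j'' ∘ u') ∘ u              ≈⟨ assoc ⟩
      j'' ∘ u' ∘ u                ∎

module SignatureLemmas {o ℓ e} {C : Category o ℓ e} (DC : Distributive C)
                       (Σᵥ : Endofunctor C) (Σ꜀ : Bifunctor C) where
  open DistOps DC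
  open SigOps DC Σᵥ Σ꜀
  open HomReasoning C
  open ProductCoproductLemmas DC
  private
    module Σᵥ = Endofunctor Σᵥ
    module Σ꜀ = Bifunctor Σ꜀

  Σ'₁-resp-≈ : ∀ {X X' Y Y'} {f f' : X ⇒ X'} {g g' : Y ⇒ Y'} →
               f ≈ f' → g ≈ g' → Σ'₁ f g ≈ Σ'₁ f' g'
  Σ'₁-resp-≈ p q = +₁-cong (Σᵥ.F-resp-≈ q) (Σ꜀.F-resp-≈ p q)

  Σ'₁-identity : ∀ {X Y} → Σ'₁ (id {X}) (id {Y}) ≈ id
  Σ'₁-identity = trans (+₁-cong Σᵥ.identity Σ꜀.identity) +₁-identity

  Σ'₁-homomorphism : ∀ {X X' X'' Y Y' Y''}
                       {f : X ⇒ X'} {f' : X' ⇒ X''} {g : Y ⇒ Y'} {g' : Y' ⇒ Y''} →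
                     Σ'₁ (f' ∘ f) (g' ∘ g) ≈ Σ'₁ f' g' ∘ Σ'₁ f g
  Σ'₁-homomorphism = trans (+₁-cong Σᵥ.homomorphism Σ꜀.homomorphism) (sym +₁∘+₁)

module FreeAlgebraLemmas {o ℓ e} {C : Category o ℓ e} (DC : Distributive C)
                         (Σᵥ : Endofunctor C) (Σ꜀ : Bifunctor C)
                         (FA : FreeAlgebras DC Σᵥ Σ꜀) where
  open DistOps DC
  open SigOps DC Σᵥ Σ꜀
  open FreeAlgebras FA
  open HomReasoning C
  open SignatureLemmas DC Σᵥ Σ꜀

  ext-resp-≈ : ∀ {X A} {a : Σ₀ A ⇒ A} {f f' : X ⇒ A} → f ≈ f' → ext a f ≈ ext a f'
  ext-resp-≈ f≈f' = ext-unique (trans ext-η f≈f') ext-alg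

  ext-fusion : ∀ {X A A'} {a : Σ₀ A ⇒ A} {a' : Σ₀ A' ⇒ A'} {h : A ⇒ A'} {f : X ⇒ A} →
               h ∘ a ≈ a' ∘ Σ₁ h → h ∘ ext a f ≈ ext a' (h ∘ f)
  ext-fusion {a = a} {a'} {h} {f} h-hom = ext-unique (trans assoc (refl⟩∘⟨ ext-η)) (begin
    (h ∘ ext a f) ∘ alg        ≈⟨ assoc ⟩
    h ∘ ext a f ∘ alg          ≈⟨ refl⟩∘⟨ ext-alg ⟩
    h ∘ a ∘ Σ₁ (ext a f)       ≈⟨ sym-assoc ⟩
    (h ∘ a) ∘ Σ₁ (ext a f)     ≈⟨ h-hom ⟩∘⟨refl ⟩
    (a' ∘ Σ₁ h) ∘ Σ₁ (ext a f) ≈⟨ assoc ⟩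
    a' ∘ Σ₁ h ∘ Σ₁ (ext a f)   ≈⟨ refl⟩∘⟨ sym Σ'₁-homomorphism ⟩
    a' ∘ Σ₁ (h ∘ ext a f)      ∎)

  id-is-algebra-morphism : ∀ {A} {a : Σ₀ A ⇒ A} → id ∘ a ≈ a ∘ Σ₁ id
  id-is-algebra-morphism = trans identityˡ (trans (sym identityʳ) (refl⟩∘⟨ sym Σ'₁-identity))

  Σ⋆₁-identity : ∀ {X} → Σ⋆₁ (id {X}) ≈ id
  Σ⋆₁-identity = sym (ext-unique (trans identityˡ (sym identityʳ)) id-is-algebra-morphism)

  Σ⋆₁-homomorphism : ∀ {X Y Z} {f : X ⇒ Y} {g : Y ⇒ Z} → Σ⋆₁ (g ∘ f) ≈ Σ⋆₁ g ∘ Σ⋆₁ f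
  Σ⋆₁-homomorphism {f = f} {g} = sym (trans (ext-fusion ext-alg) (ext-resp-≈ (begin
    Σ⋆₁ g ∘ ηˢ ∘ f   ≈⟨ sym-assoc ⟩
    (Σ⋆₁ g ∘ ηˢ) ∘ f ≈⟨ ext-η ⟩∘⟨refl ⟩
    (ηˢ ∘ g) ∘ f     ≈⟨ assoc ⟩
    ηˢ ∘ g ∘ f       ∎)))

  initiality : ∀ {A} {a : Σ₀ A ⇒ A} {h : Σ⋆ 𝟘 ⇒ A} → h ∘ alg ≈ a ∘ Σ₁ h → h ≈ ext a ¡
  initiality = ext-unique (¡-unique _)

  initial-endo-id : ∀ {h : Σ⋆ 𝟘 ⇒ Σ⋆ 𝟘} → h ∘ alg ≈ alg ∘ Σ₁ h → h ≈ id
  initial-endo-id h-hom = trans (initiality h-hom) (sym (initiality id-is-algebra-morphism))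

  alg⁻¹ : Σ⋆ 𝟘 ⇒ Σ₀ (Σ⋆ 𝟘)
  alg⁻¹ = ext (Σ₁ alg) ¡

  alg∘alg⁻¹ : alg ∘ alg⁻¹ ≈ id
  alg∘alg⁻¹ = initial-endo-id (begin
    (alg ∘ alg⁻¹) ∘ alg    ≈⟨ assoc ⟩
    alg ∘ alg⁻¹ ∘ alg      ≈⟨ refl⟩∘⟨ ext-alg ⟩
    alg ∘ Σ₁ alg ∘ Σ₁ alg⁻¹ ≈⟨ refl⟩∘⟨ sym Σ'₁-homomorphism ⟩
    alg ∘ Σ₁ (alg ∘ alg⁻¹) ∎)

  alg⁻¹∘alg : alg⁻¹ ∘ alg ≈ id
  alg⁻¹∘alg = begin
    alg⁻¹ ∘ alg            ≈⟨ ext-alg ⟩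
    Σ₁ alg ∘ Σ₁ alg⁻¹      ≈⟨ sym Σ'₁-homomorphism ⟩
    Σ₁ (alg ∘ alg⁻¹)       ≈⟨ Σ'₁-resp-≈ alg∘alg⁻¹ alg∘alg⁻¹ ⟩
    Σ₁ id                  ≈⟨ Σ'₁-identity ⟩
    id                     ∎

module OperationalModels {o ℓ e} {C : Category o ℓ e} (DC : Distributive C)
                         (Σᵥ : Endofunctor C) (Σ꜀ : Bifunctor C)
                         (FA : FreeAlgebras DC Σᵥ Σ꜀)
                         (TM : StrongMonad DC) (D : MixedFunctor C)
                         (L : SeparatedLaw DC Σᵥ Σ꜀ FA TM D) where
  open Setup DC Σᵥ Σ꜀ FA TM D L
  open StrongMonad TM using (η-natural)
  open HomReasoning C
  open ProductCoproductLemmas DC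
  open SignatureLemmas DC Σᵥ Σ꜀
  open FreeAlgebraLemmas DC Σᵥ Σ꜀ FA

  ∇♯∘Σ⋆₁inl : ∇♯ ∘ Σ⋆₁ inl ≈ μˢ₀
  ∇♯∘Σ⋆₁inl = begin
    (μˢ ∘ Σ⋆₁ ∇) ∘ Σ⋆₁ inl ≈⟨ assoc ⟩
    μˢ ∘ Σ⋆₁ ∇ ∘ Σ⋆₁ inl   ≈⟨ refl⟩∘⟨ sym Σ⋆₁-homomorphism ⟩
    μˢ ∘ Σ⋆₁ (∇ ∘ inl)     ≈⟨ refl⟩∘⟨ ext-resp-≈ (refl⟩∘⟨ inl-β) ⟩
    μˢ ∘ Σ⋆₁ id            ≈⟨ refl⟩∘⟨ Σ⋆₁-identity ⟩
    μˢ ∘ id                ≈⟨ identityʳ ⟩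
    μˢ                     ∎

  ρᵛ-component : T.F₁ (D.F₁ id ∇♯) ∘ (η ∘ D.F₁ id (Σ⋆₁ inl) ∘ ρᵛ {μΣ}) ∘ Σᵥ.F₁ id ≈ γᵛ
  ρᵛ-component = begin
    T.F₁ (D.F₁ id ∇♯) ∘ (η ∘ D.F₁ id (Σ⋆₁ inl) ∘ ρᵛ) ∘ Σᵥ.F₁ id
      ≈⟨ refl⟩∘⟨ trans (refl⟩∘⟨ Σᵥ.identity) identityʳ ⟩
    T.F₁ (D.F₁ id ∇♯) ∘ η ∘ D.F₁ id (Σ⋆₁ inl) ∘ ρᵛ
      ≈⟨ trans sym-assoc (η-natural ⟩∘⟨refl) ⟩
    (η ∘ D.F₁ id ∇♯) ∘ D.F₁ id (Σ⋆₁ inl) ∘ ρᵛ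
      ≈⟨ trans assoc (refl⟩∘⟨ sym-assoc) ⟩
    η ∘ (D.F₁ id ∇♯ ∘ D.F₁ id (Σ⋆₁ inl)) ∘ ρᵛ
      ≈⟨ refl⟩∘⟨ sym D.homomorphism ⟩∘⟨refl ⟩
    η ∘ D.F₁ (id ∘ id) (∇♯ ∘ Σ⋆₁ inl) ∘ ρᵛ
      ≈⟨ refl⟩∘⟨ D.F-resp-≈ identityˡ ∇♯∘Σ⋆₁inl ⟩∘⟨refl ⟩
    γᵛ ∎

  stepᶜ : μΣ ⇒ B₀ μΣ μΣ → S꜀ ⇒ T.F₀ μΣ
  stepᶜ g = T.F₁ ∇♯ ∘ ρᶜ {μΣ} {μΣ} ∘ Σ꜀.F₁ ⟨ id , g ⟩ id

  stepᶜ-resp-≈ : ∀ {g g'} → g ≈ g' → stepᶜ g ≈ stepᶜ g'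
  stepᶜ-resp-≈ g≈g' = refl⟩∘⟨ refl⟩∘⟨ Σ꜀.F-resp-≈ (⟨⟩-cong refl g≈g') refl

  model-rhs≈γᵛ+stepᶜ : ∀ g → B₁ id ∇♯ ∘ ρ {μΣ} {μΣ} ∘ Σ'₁ ⟨ id , g ⟩ id ≈ γᵛ +₁ stepᶜ g
  model-rhs≈γᵛ+stepᶜ g = trans (refl⟩∘⟨ +₁∘+₁) (trans +₁∘+₁ (+₁-cong ρᵛ-component refl))

  model-algebra : Σ₀ (μΣ ×ₒ B₀ μΣ μΣ) ⇒ μΣ ×ₒ B₀ μΣ μΣ
  model-algebra = ⟨ ι ∘ Σ₁ fst , B₁ id ∇♯ ∘ ρ {μΣ} {μΣ} ∘ Σ'₁ id fst ⟩

  ⟨id,model⟩≈ext : ∀ {g} → IsOperationalModel g → ⟨ id , g ⟩ ≈ ext model-algebra ¡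
  ⟨id,model⟩≈ext {g} g-model = initiality (begin
    ⟨ id , g ⟩ ∘ ι
      ≈⟨ trans ⟨⟩∘ (⟨⟩-cong fst-component (trans g-model snd-component)) ⟩
    ⟨ (ι ∘ Σ₁ fst) ∘ Σ₁ ⟨ id , g ⟩ , (B₁ id ∇♯ ∘ ρ ∘ Σ'₁ id fst) ∘ Σ₁ ⟨ id , g ⟩ ⟩
      ≈⟨ sym ⟨⟩∘ ⟩
    model-algebra ∘ Σ₁ ⟨ id , g ⟩ ∎)
    where
    fst-component : id ∘ ι ≈ (ι ∘ Σ₁ fst) ∘ Σ₁ ⟨ id , g ⟩
    fst-component = begin
      id ∘ ι                       ≈⟨ trans identityˡ (sym identityʳ) ⟩
      ι ∘ id                       ≈⟨ refl⟩∘⟨ sym Σ'₁-identity ⟩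
      ι ∘ Σ₁ id                    ≈⟨ refl⟩∘⟨ Σ'₁-resp-≈ (sym fst-β) (sym fst-β) ⟩
      ι ∘ Σ₁ (fst ∘ ⟨ id , g ⟩)    ≈⟨ refl⟩∘⟨ Σ'₁-homomorphism ⟩
      ι ∘ Σ₁ fst ∘ Σ₁ ⟨ id , g ⟩   ≈⟨ sym-assoc ⟩
      (ι ∘ Σ₁ fst) ∘ Σ₁ ⟨ id , g ⟩ ∎
    snd-component : B₁ id ∇♯ ∘ ρ ∘ Σ'₁ ⟨ id , g ⟩ id
                    ≈ (B₁ id ∇♯ ∘ ρ ∘ Σ'₁ id fst) ∘ Σ₁ ⟨ id , g ⟩
    snd-component = begin
      B₁ id ∇♯ ∘ ρ ∘ Σ'₁ ⟨ id , g ⟩ id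
        ≈⟨ refl⟩∘⟨ refl⟩∘⟨ Σ'₁-resp-≈ (sym identityˡ) (sym fst-β) ⟩
      B₁ id ∇♯ ∘ ρ ∘ Σ'₁ (id ∘ ⟨ id , g ⟩) (fst ∘ ⟨ id , g ⟩)
        ≈⟨ refl⟩∘⟨ refl⟩∘⟨ Σ'₁-homomorphism ⟩
      B₁ id ∇♯ ∘ ρ ∘ Σ'₁ id fst ∘ Σ₁ ⟨ id , g ⟩
        ≈⟨ trans (refl⟩∘⟨ sym-assoc) sym-assoc ⟩
      (B₁ id ∇♯ ∘ ρ ∘ Σ'₁ id fst) ∘ Σ₁ ⟨ id , g ⟩ ∎

  operational-model-unique : ∀ {g g'} → IsOperationalModel g → IsOperationalModel g' → g ≈ g'
  operational-model-unique {g} {g'} g-model g'-model = begin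
    g                ≈⟨ sym snd-β ⟩
    snd ∘ ⟨ id , g ⟩  ≈⟨ refl⟩∘⟨ trans (⟨id,model⟩≈ext g-model) (sym (⟨id,model⟩≈ext g'-model)) ⟩
    snd ∘ ⟨ id , g' ⟩ ≈⟨ snd-β ⟩
    g'               ∎

  stepᶜ∘Σ꜀ι : ∀ g → stepᶜ g ∘ Σ꜀.F₁ ι id ≈ T.F₁ ∇♯ ∘ ρᶜ {μΣ} {μΣ} ∘ Σ꜀.F₁ ⟨ ι , g ∘ ι ⟩ id
  stepᶜ∘Σ꜀ι g = begin
    (T.F₁ ∇♯ ∘ ρᶜ ∘ Σ꜀.F₁ ⟨ id , g ⟩ id) ∘ Σ꜀.F₁ ι id
      ≈⟨ trans assoc (refl⟩∘⟨ assoc) ⟩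
    T.F₁ ∇♯ ∘ ρᶜ ∘ Σ꜀.F₁ ⟨ id , g ⟩ id ∘ Σ꜀.F₁ ι id
      ≈⟨ refl⟩∘⟨ refl⟩∘⟨ sym Σ꜀.homomorphism ⟩
    T.F₁ ∇♯ ∘ ρᶜ ∘ Σ꜀.F₁ (⟨ id , g ⟩ ∘ ι) (id ∘ id)
      ≈⟨ refl⟩∘⟨ refl⟩∘⟨ Σ꜀.F-resp-≈ (trans ⟨⟩∘ (⟨⟩-cong identityˡ refl)) identityˡ ⟩
    T.F₁ ∇♯ ∘ ρᶜ ∘ Σ꜀.F₁ ⟨ ι , g ∘ ι ⟩ id ∎

  Σ꜀ι-cancelʳ : ∀ {X} {f f' : S꜀ ⇒ X} → f ∘ Σ꜀.F₁ ι id ≈ f' ∘ Σ꜀.F₁ ι id → f ≈ f'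
  Σ꜀ι-cancelʳ = split-epi-cancelʳ
    (trans (sym Σ꜀.homomorphism) (trans (Σ꜀.F-resp-≈ alg∘alg⁻¹ identityˡ) Σ꜀.identity))

  module _ {γ : μΣ ⇒ B₀ μΣ μΣ} (γ-model : IsOperationalModel γ) where

    γᵛ+stepᶜ≈γ∘ι : γᵛ +₁ stepᶜ γ ≈ γ ∘ ι
    γᵛ+stepᶜ≈γ∘ι = sym (trans γ-model (model-rhs≈γᵛ+stepᶜ γ))

    stepᶜ-solves : stepᶜ γ ∘ Σ꜀.F₁ ι id
                   ≈ T.F₁ ∇♯ ∘ ρᶜ {μΣ} {μΣ} ∘ Σ꜀.F₁ ⟨ ι , γᵛ +₁ stepᶜ γ ⟩ id
    stepᶜ-solves = trans (stepᶜ∘Σ꜀ι γ)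
      (refl⟩∘⟨ refl⟩∘⟨ Σ꜀.F-resp-≈ (⟨⟩-cong refl (sym γᵛ+stepᶜ≈γ∘ι)) refl)

    solution-unique : ∀ {δ} → δ ∘ Σ꜀.F₁ ι id ≈ T.F₁ ∇♯ ∘ ρᶜ {μΣ} {μΣ} ∘ Σ꜀.F₁ ⟨ ι , γᵛ +₁ δ ⟩ id →
                      δ ≈ stepᶜ γ
    solution-unique {δ} δ-solves =
      trans δ≈stepᶜ (stepᶜ-resp-≈ (operational-model-unique candidate-model γ-model))
      where
      candidate : μΣ ⇒ B₀ μΣ μΣ
      candidate = (γᵛ +₁ δ) ∘ alg⁻¹
      candidate∘ι : candidate ∘ ι ≈ γᵛ +₁ δ
      candidate∘ι = trans assoc (trans (refl⟩∘⟨ alg⁻¹∘alg) identityʳ)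
      δ≈stepᶜ : δ ≈ stepᶜ candidate
      δ≈stepᶜ = Σ꜀ι-cancelʳ (trans δ-solves (trans
        (refl⟩∘⟨ refl⟩∘⟨ Σ꜀.F-resp-≈ (⟨⟩-cong refl (sym candidate∘ι)) refl)
        (sym (stepᶜ∘Σ꜀ι candidate))))
      candidate-model : IsOperationalModel candidate
      candidate-model = trans candidate∘ι
        (trans (+₁-cong refl δ≈stepᶜ) (sym (model-rhs≈γᵛ+stepᶜ candidate)))

proposition3p2 : ∀ {o ℓ e} {C : Category o ℓ e} (DC : Distributive C)
                   (Σᵥ : Endofunctor C) (Σ꜀ : Bifunctor C)
                   (FA : FreeAlgebras DC Σᵥ Σ꜀)
                   (TM : StrongMonad DC) (D : MixedFunctor C)
                   (L : SeparatedLaw DC Σᵥ Σ꜀ FA TM D) →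
                 let open Setup DC Σᵥ Σ꜀ FA TM D L in
                 (γ : μΣ ⇒ B₀ μΣ μΣ) → IsOperationalModel γ →
                 Σ[ γᶜ ∈ S꜀ ⇒ T.F₀ μΣ ]
                   ( ( (γᶜ ∘ Σ꜀.F₁ ι id
                         ≈ T.F₁ ∇♯ ∘ ρᶜ {μΣ} {μΣ} ∘ Σ꜀.F₁ ⟨ ι , γᵛ +₁ γᶜ ⟩ id)
                     × (∀ (δ : S꜀ ⇒ T.F₀ μΣ) →
                          δ ∘ Σ꜀.F₁ ι id
                            ≈ T.F₁ ∇♯ ∘ ρᶜ {μΣ} {μΣ} ∘ Σ꜀.F₁ ⟨ ι , γᵛ +₁ δ ⟩ id →
                          δ ≈ γᶜ) )
                   × (γᵛ +₁ γᶜ ≈ γ ∘ ι) )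
proposition3p2 DC Σᵥ Σ꜀ FA TM D L γ γ-model =
  stepᶜ γ , (stepᶜ-solves γ-model , λ δ → solution-unique γ-model) , γᵛ+stepᶜ≈γ∘ι γ-model
  where open OperationalModels DC Σᵥ Σ꜀ FA TM D L
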